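{- Let $E$ be a finite set, $a,b\in E$ distinct, $(\sigma_\circ,\sigma_\bullet)$ any pair in $S_E$, and $(\sigma_\circ^\oplus,\sigma_\bullet^\oplus)$ its reroute relative to $(a,b)$. If $\chi$ and $\chi^\oplus$ are the synthetic Euler characteristics of $(\sigma_\circ,\sigma_\bullet)$ and $(\sigma_\circ^\oplus,\sigma_\bullet^\oplus)$, then $\chi-\chi^\oplus=z(\sigma_\circ\sigma_\bullet)-z(\sigma_\circ^\oplus\sigma_\bullet^\oplus)$.
   Context: Permutations compose functionally; $z(\pi)$ is the number of $\pi$-orbits (fixed points included). The synthetic Euler characteristic of a pair $(x,y)$ in $S_F$ is $z(x)+z(y)-|F|+z(xy)$. Reroute relative to $(a,b)$: $E^\oplus=(E\setminus\{a\})\sqcup\{a_\circ,a_\bullet\}$; $\sigma_\circ^\oplus$ is obtained from the disjoint cycle decomposition of $\sigma_\circ$ (fixed points as 1-cycles) by replacing $a$ by $a_\circ$ and inserting $a_\bullet$ immediately before $b$ in the cycle containing $b$; $\sigma_\bullet^\oplus$ is obtained from that of $\sigma_\bullet$ by replacing $a$ by $a_\bullet$ and adjoining the fixed point $a_\circ$. -}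

module Defs where

open import Data.Nat using (ℕ; zero; suc)
open import Data.Fin using (Fin; zero; suc; toℕ; _≤_)
open import Data.Fin.Properties using (_≟_; _≤?_; all?)
open import Data.List using (List; length; filter)
open import Data.List using () renaming (allFin to allFinL)
open import Data.Integer using (ℤ; +_; _+_; _-_)
open import Relation.Nullary using (Dec; yes; no)
open import Function using (_∘_)

iter : ∀ {m} → (Fin m → Fin m) → ℕ → Fin m → Fin m
iter f zero    x = x
iter f (suc k) x = f (iter f k x)

-- x is the least element (in the order of Fin m) of its f-orbit
-- { f^k x | k < m }; for a permutation f of Fin m the orbit of x is
-- exactly { f^k x | k < m } since every cycle has length ≤ m.
OrbitMin : ∀ {m} → (Fin m → Fin m) → Fin m → Set
OrbitMin {m} f x = (k : Fin m) → x ≤ iter f (toℕ k) x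

orbitMin? : ∀ {m} (f : Fin m → Fin m) (x : Fin m) → Dec (OrbitMin f x)
orbitMin? f x = all? (λ k → x ≤? iter f (toℕ k) x)

-- z(π): the number of π-orbits (fixed points included), counted as the
-- number of orbits via their least representatives.
z : ∀ {m} → (Fin m → Fin m) → ℕ
z {m} f = length (filter (orbitMin? f) (allFinL m))

-- synthetic Euler characteristic of (x , y) in S_F, F = Fin m;
-- xy is functional composition x ∘ y.
χ : ∀ {m} → (Fin m → Fin m) → (Fin m → Fin m) → ℤ
χ {m} x y = (((+ z x) + (+ z y)) - (+ m)) + (+ z (x ∘ y))

-- Reroute relative to (a , b).  E = Fin n, E⊕ = Fin (suc n) where
--   a• = zero,  a∘ = suc a,  and every e ∈ E ∖ {a} is represented by suc e.

-- σ∘⊕: cycle decomposition of σ∘ with a renamed a∘ and a• inserted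
-- immediately before b in the cycle of b; i.e. the predecessor of b now
-- maps to a•, and a• maps to b.
rerouteWhite : ∀ {n} → Fin n → Fin n → (Fin n → Fin n) → Fin (suc n) → Fin (suc n)
rerouteWhite a b σ zero    = suc b
rerouteWhite a b σ (suc x) with σ x ≟ b
... | yes _ = zero
... | no  _ = suc (σ x)

relabelBlack : ∀ {n} → Fin n → Fin n → Fin (suc n)
relabelBlack a y with y ≟ a
... | yes _ = zero
... | no  _ = suc y

-- σ•⊕: σ• with a renamed a•, plus the fixed point a∘.
rerouteBlack : ∀ {n} → Fin n → (Fin n → Fin n) → Fin (suc n) → Fin (suc n)
rerouteBlack a σ zero    = relabelBlack a (σ a)
rerouteBlack a σ (suc x) with x ≟ a
... | yes _ = suc a
... | no  _ = relabelBlack a (σ x)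

-- Rerouting only splices a• into the cycle of b, so σ∘⊕ has as many orbits as σ∘; and
-- σ•⊕ is σ• with the fixed point a∘ adjoined, conjugated by the transposition of a∘ and
-- a•, so it has exactly one orbit more.  Since |E⊕| = |E| + 1, only the last term of χ
-- survives in the difference.  Orbit counts are compared through maps that preserve and
-- reflect reachability: counting orbits by their least elements, such a map with a
-- section induces a bijection of orbits.
module Submission where

open import Defs
open import Data.Nat as ℕ using (ℕ; zero; suc; _+_; _∸_; z≤n; s≤s)
import Data.Nat.Properties as ℕ
open import Data.Fin as Fin using (Fin; zero; suc; toℕ; fromℕ<)
open import Data.Fin.Properties using (_≟_; _≤?_; ≤-antisym; pigeonhole; toℕ<n; toℕ-fromℕ<; ¬∀⟶∃¬; injective⇒≤)
open import Data.Fin.Induction using (<-wellFounded)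
open import Data.Fin.Permutation using (Permutation′; _⟨$⟩ʳ_; _⟨$⟩ˡ_; inverseʳ; lift₀)
open import Data.Nat.Induction using (<-rec)
open import Data.Integer as ℤ using (ℤ; +_; _-_)
open import Data.Integer.Properties using (pos-+)
open import Data.Integer.Tactic.RingSolver using (solve-∀)
open import Data.List using (List; []; _∷_; length; filter; lookup; map; allFin)
open import Data.List.Properties using (filter-accept; filter-≐; map-tabulate)
open import Data.List.Relation.Unary.All as All using ()
open import Data.List.Relation.Unary.AllPairs using (_∷_)
open import Data.List.Relation.Unary.Any using (index)
open import Data.List.Relation.Unary.Any.Properties using (lookup-index)
open import Data.List.Relation.Unary.Unique.Propositional using (Unique)
import Data.List.Relation.Unary.Unique.Propositional.Properties as Unique
open import Data.List.Membership.Propositional using (_∈_)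
open import Data.List.Membership.Propositional.Properties using (∈-filter⁺; ∈-filter⁻; ∈-lookup; ∈-allFin)
open import Data.Product using (∃-syntax; _,_; proj₁; proj₂; _×_)
open import Data.Empty using (⊥-elim)
open import Function using (_∘_; id)
open import Function.Definitions using (Injective)
open import Function.Properties.Inverse using (↔⇒↣)
open import Function.Bundles using (Injection)
open import Induction.WellFounded using (Acc; acc)
open import Level using (0ℓ)
open import Relation.Binary.Definitions using (Symmetric)
open import Relation.Binary.PropositionalEquality
open import Relation.Nullary using (yes; no)
open import Relation.Unary using (Pred; Decidable)

Reach : ∀ {m} → (Fin m → Fin m) → Fin m → Fin m → Set
Reach f x y = ∃[ k ] iter f k x ≡ y

module _ {m : ℕ} (f : Fin m → Fin m) where

  iter-+ : ∀ j k x → iter f (j + k) x ≡ iter f j (iter f k x)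
  iter-+ zero    k x = refl
  iter-+ (suc j) k x = cong f (iter-+ j k x)

  iter-commute : ∀ k x → iter f k (f x) ≡ f (iter f k x)
  iter-commute zero    x = refl
  iter-commute (suc k) x = cong f (iter-commute k x)

  Reach-refl : ∀ {x} → Reach f x x
  Reach-refl = 0 , refl

  Reach-step : ∀ x → Reach f x (f x)
  Reach-step x = 1 , refl

  Reach-trans : ∀ {x y w} → Reach f x y → Reach f y w → Reach f x w
  Reach-trans {x} (k , refl) (j , refl) = j + k , iter-+ j k x

  -- Pigeonhole on the first m + 1 iterates finds a repetition, which shortens any long iterate.
  iter-below : ∀ x k → ∃[ j ] iter f (toℕ j) x ≡ iter f k x
  iter-below x = <-rec _ go
    where
    go : ∀ k → (∀ {k′} → k′ ℕ.< k → ∃[ j ] iter f (toℕ j) x ≡ iter f k′ x) →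
         ∃[ j ] iter f (toℕ j) x ≡ iter f k x
    go k rec with k ℕ.<? m
    ... | yes k<m = fromℕ< k<m , cong (λ t → iter f t x) (toℕ-fromℕ< k<m)
    ... | no k≮m with pigeonhole (ℕ.n<1+n m) (λ (i : Fin (suc m)) → iter f (toℕ i) x)
    ... | i , j , i<j , repeat = proj₁ shorter , trans (proj₂ shorter) shortcut
      where
      j≤k : toℕ j ℕ.≤ k
      j≤k = ℕ.≤-trans (ℕ.s≤s⁻¹ (toℕ<n j)) (ℕ.≮⇒≥ k≮m)
      k-j+j≡k : k ∸ toℕ j + toℕ j ≡ k
      k-j+j≡k = ℕ.m∸n+n≡m j≤k
      shorter : ∃[ j′ ] iter f (toℕ j′) x ≡ iter f (k ∸ toℕ j + toℕ i) x
      shorter = rec (subst (k ∸ toℕ j + toℕ i ℕ.<_) k-j+j≡k (ℕ.+-monoʳ-< (k ∸ toℕ j) i<j))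
      shortcut : iter f (k ∸ toℕ j + toℕ i) x ≡ iter f k x
      shortcut = begin
        iter f (k ∸ toℕ j + toℕ i) x        ≡⟨ iter-+ (k ∸ toℕ j) (toℕ i) x ⟩
        iter f (k ∸ toℕ j) (iter f (toℕ i) x) ≡⟨ cong (iter f (k ∸ toℕ j)) repeat ⟩
        iter f (k ∸ toℕ j) (iter f (toℕ j) x) ≡⟨ iter-+ (k ∸ toℕ j) (toℕ j) x ⟨
        iter f (k ∸ toℕ j + toℕ j) x        ≡⟨ cong (λ t → iter f t x) k-j+j≡k ⟩
        iter f k x                          ∎
        where open ≡-Reasoning

  OrbitMin⇒≤ : ∀ {x y} → OrbitMin f x → Reach f x y → x Fin.≤ y
  OrbitMin⇒≤ {x} min (k , refl) with j , iterⱼ≡iterₖ ← iter-below x k =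
    subst (x Fin.≤_) iterⱼ≡iterₖ (min j)

  reaches-OrbitMin : ∀ y → ∃[ r ] OrbitMin f r × Reach f y r
  reaches-OrbitMin y = go y (<-wellFounded y)
    where
    go : ∀ y → Acc Fin._<_ y → ∃[ r ] OrbitMin f r × Reach f y r
    go y (acc smaller) with orbitMin? f y
    ... | yes min = y , min , Reach-refl
    ... | no ¬min
      with k , y≰ ← ¬∀⟶∃¬ m _ (λ k → y ≤? iter f (toℕ k) y) ¬min
      with r , min , reach ← go (iter f (toℕ k) y) (smaller (ℕ.≰⇒> y≰))
      = r , min , Reach-trans (toℕ k , refl) reach

  module _ (f-injective : Injective _≡_ _≡_ f) where

    iter-injective : ∀ k {x y} → iter f k x ≡ iter f k y → x ≡ y
    iter-injective zero    eq = eq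
    iter-injective (suc k) eq = iter-injective k (f-injective eq)

    iter-returns : ∀ x → ∃[ p ] iter f (suc p) x ≡ x
    iter-returns x with pigeonhole (ℕ.n<1+n m) (λ (i : Fin (suc m)) → iter f (toℕ i) x)
    ... | i , j , i<j , repeat with p , i+1+p≡j ← ℕ.m≤n⇒∃[o]m+o≡n i<j =
      p , iter-injective (toℕ i) (begin
        iter f (toℕ i) (iter f (suc p) x) ≡⟨ iter-+ (toℕ i) (suc p) x ⟨
        iter f (toℕ i + suc p) x          ≡⟨ cong (λ t → iter f t x) (trans (ℕ.+-suc (toℕ i) p) i+1+p≡j) ⟩
        iter f (toℕ j) x                  ≡⟨ repeat ⟨
        iter f (toℕ i) x                  ∎)
      where open ≡-Reasoning

    Reach-stepBack : ∀ x → Reach f (f x) x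
    Reach-stepBack x with p , returns ← iter-returns x = p , trans (iter-commute p x) returns

    Reach-sym : Symmetric (Reach f)
    Reach-sym (zero  , refl) = Reach-refl
    Reach-sym {x} (suc k , refl) = Reach-trans (Reach-stepBack (iter f k x)) (Reach-sym (k , refl))

Reach-map : ∀ {m m′} {f : Fin m → Fin m} {g : Fin m′ → Fin m′} (θ : Fin m → Fin m′) →
  (∀ x → Reach g (θ x) (θ (f x))) → ∀ {x y} → Reach f x y → Reach g (θ x) (θ y)
Reach-map {g = g} θ step (zero  , refl) = Reach-refl g
Reach-map {f = f} {g} θ step {x} (suc k , refl) =
  Reach-trans g (Reach-map θ step (k , refl)) (step (iter f k x))

count : ∀ {n} {P : Pred (Fin n) 0ℓ} → Decidable P → ℕ
count {n} P? = length (filter P? (allFin n))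

lookup-injective : ∀ {A : Set} {xs : List A} → Unique xs → ∀ i j → lookup xs i ≡ lookup xs j → i ≡ j
lookup-injective (_ ∷ _)      zero    zero    _  = refl
lookup-injective (x∉xs ∷ _)   zero    (suc j) eq = ⊥-elim (All.lookup x∉xs (∈-lookup j) eq)
lookup-injective (x∉xs ∷ _)   (suc i) zero    eq = ⊥-elim (All.lookup x∉xs (∈-lookup i) (sym eq))
lookup-injective (_ ∷ unique) (suc i) (suc j) eq = cong suc (lookup-injective unique i j eq)

count-≤-of-injection : ∀ {m m′} {P : Pred (Fin m) 0ℓ} {Q : Pred (Fin m′) 0ℓ} (P? : Decidable P) (Q? : Decidable Q)
  (h : Fin m → Fin m′) → (∀ {x} → P x → Q (h x)) → (∀ {x y} → P x → P y → h x ≡ h y → x ≡ y) →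
  count P? ℕ.≤ count Q?
count-≤-of-injection {m} {m′} {P} P? Q? h P⇒Q h-injective = injective⇒≤ {f = F} F-injective
  where
  L = filter P? (allFin m)
  L′ = filter Q? (allFin m′)
  P-lookup : ∀ i → P (lookup L i)
  P-lookup i = proj₂ (∈-filter⁻ P? {xs = allFin m} (∈-lookup {xs = L} i))
  h-lookup∈L′ : ∀ i → h (lookup L i) ∈ L′
  h-lookup∈L′ i = ∈-filter⁺ Q? {xs = allFin m′} (∈-allFin (h (lookup L i))) (P⇒Q (P-lookup i))
  F : Fin (length L) → Fin (length L′)
  F i = index (h-lookup∈L′ i)
  F-injective : ∀ {i j} → F i ≡ F j → i ≡ j
  F-injective {i} {j} eq = lookup-injective (Unique.filter⁺ P? (Unique.allFin⁺ m)) i j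
    (h-injective (P-lookup i) (P-lookup j)
      (trans (lookup-index (h-lookup∈L′ i)) (trans (cong (lookup L′) eq) (sym (lookup-index (h-lookup∈L′ j))))))

-- Choosing an orbit minimum in the f-orbit of θ x gives a map from g-orbits to f-orbits.
z≤z-of-reflecting : ∀ {m m′} {f : Fin m → Fin m} {g : Fin m′ → Fin m′} → Symmetric (Reach f) →
  (θ : Fin m′ → Fin m) → (∀ {x y} → Reach f (θ x) (θ y) → Reach g x y) → z g ℕ.≤ z f
z≤z-of-reflecting {m} {m′} {f} {g} f-sym θ reflects =
  count-≤-of-injection (orbitMin? g) (orbitMin? f) rep (λ {x} _ → proj₁ (proj₂ (reaches-OrbitMin f (θ x)))) rep-injective
  where
  rep : Fin m′ → Fin m
  rep x = proj₁ (reaches-OrbitMin f (θ x))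
  reaches-rep : ∀ x → Reach f (θ x) (rep x)
  reaches-rep x = proj₂ (proj₂ (reaches-OrbitMin f (θ x)))
  rep-injective : ∀ {x y} → OrbitMin g x → OrbitMin g y → rep x ≡ rep y → x ≡ y
  rep-injective {x} {y} min-x min-y eq =
    ≤-antisym (OrbitMin⇒≤ g min-x (reflects x→y)) (OrbitMin⇒≤ g min-y (reflects y→x))
    where
    x→y : Reach f (θ x) (θ y)
    x→y = Reach-trans f (reaches-rep x) (f-sym (subst (Reach f (θ y)) (sym eq) (reaches-rep y)))
    y→x : Reach f (θ y) (θ x)
    y→x = Reach-trans f (reaches-rep y) (f-sym (subst (Reach f (θ x)) eq (reaches-rep x)))

z-reachCorrespondence : ∀ {m m′} {f : Fin m → Fin m} {g : Fin m′ → Fin m′} → Injective _≡_ _≡_ f →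
  (φ : Fin m′ → Fin m) →
  (∀ {x y} → Reach g x y → Reach f (φ x) (φ y)) → (∀ {x y} → Reach f (φ x) (φ y) → Reach g x y) →
  (ψ : Fin m → Fin m′) → (∀ y → φ (ψ y) ≡ y) → z g ≡ z f
z-reachCorrespondence {f = f} {g} f-injective φ preserves reflects ψ φψ≡id =
  ℕ.≤-antisym (z≤z-of-reflecting (Reach-sym f f-injective) φ reflects)
              (z≤z-of-reflecting g-sym ψ ψ-reflects)
  where
  g-sym : Symmetric (Reach g)
  g-sym = reflects ∘ Reach-sym f f-injective ∘ preserves
  ψ-reflects : ∀ {x y} → Reach g (ψ x) (ψ y) → Reach f x y
  ψ-reflects {x} {y} = subst₂ (Reach f) (φψ≡id x) (φψ≡id y) ∘ preserves

z-conjugate : ∀ {m} {f g : Fin m → Fin m} → Injective _≡_ _≡_ f →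
  (φ : Fin m → Fin m) → (∀ x → φ (φ x) ≡ x) → (∀ x → g x ≡ φ (f (φ x))) → z g ≡ z f
z-conjugate {f = f} {g} f-injective φ φφ≡id g≡φfφ =
  z-reachCorrespondence f-injective φ (Reach-map φ g-step) reflects φ φφ≡id
  where
  g-step : ∀ x → Reach f (φ x) (φ (g x))
  g-step x = 1 , sym (trans (cong φ (g≡φfφ x)) (φφ≡id _))
  f-step : ∀ x → Reach g (φ x) (φ (f x))
  f-step x = 1 , trans (g≡φfφ (φ x)) (cong (φ ∘ f) (φφ≡id x))
  reflects : ∀ {x y} → Reach f (φ x) (φ y) → Reach g x y
  reflects {x} {y} = subst₂ (Reach g) (φφ≡id x) (φφ≡id y) ∘ Reach-map φ f-step

length-filter-map : ∀ {A B : Set} {P : Pred B 0ℓ} (P? : Decidable P) (h : A → B) (xs : List A) →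
  length (filter P? (map h xs)) ≡ length (filter (P? ∘ h) xs)
length-filter-map P? h []       = refl
length-filter-map P? h (x ∷ xs) with P? (h x)
... | yes _ = cong suc (length-filter-map P? h xs)
... | no  _ = length-filter-map P? h xs

module _ {n : ℕ} (π : Permutation′ n) where

  private
    π₀ : Fin (suc n) → Fin (suc n)
    π₀ = lift₀ π ⟨$⟩ʳ_

  iter-lift₀-suc : ∀ k x → iter π₀ k (suc x) ≡ suc (iter (π ⟨$⟩ʳ_) k x)
  iter-lift₀-suc zero    x = refl
  iter-lift₀-suc (suc k) x = cong π₀ (iter-lift₀-suc k x)

  OrbitMin-lift₀-suc : ∀ x → OrbitMin π₀ (suc x) → OrbitMin (π ⟨$⟩ʳ_) x
  OrbitMin-lift₀-suc x min k = ℕ.s≤s⁻¹ (OrbitMin⇒≤ π₀ min (toℕ k , iter-lift₀-suc (toℕ k) x))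

  OrbitMin-suc-lift₀ : ∀ x → OrbitMin (π ⟨$⟩ʳ_) x → OrbitMin π₀ (suc x)
  OrbitMin-suc-lift₀ x min k =
    subst (suc x Fin.≤_) (sym (iter-lift₀-suc (toℕ k) x)) (s≤s (OrbitMin⇒≤ (π ⟨$⟩ʳ_) min (toℕ k , refl)))

  z-lift₀ : z π₀ ≡ suc (z (π ⟨$⟩ʳ_))
  z-lift₀ = begin
    z π₀
      ≡⟨ cong (λ xs → length (filter (orbitMin? π₀) (zero ∷ xs))) (map-tabulate id suc) ⟨
    length (filter (orbitMin? π₀) (zero ∷ map suc (allFin n)))
      ≡⟨ cong length (filter-accept (orbitMin? π₀) (λ _ → z≤n)) ⟩
    suc (length (filter (orbitMin? π₀) (map suc (allFin n))))
      ≡⟨ cong suc (length-filter-map (orbitMin? π₀) suc (allFin n)) ⟩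
    suc (length (filter (orbitMin? π₀ ∘ suc) (allFin n)))
      ≡⟨ cong (suc ∘ length) (filter-≐ (orbitMin? π₀ ∘ suc) (orbitMin? (π ⟨$⟩ʳ_))
           (OrbitMin-lift₀-suc _ , OrbitMin-suc-lift₀ _) (allFin n)) ⟩
    suc (z (π ⟨$⟩ʳ_)) ∎
    where open ≡-Reasoning

permutation-injective : ∀ {n} (π : Permutation′ n) → Injective _≡_ _≡_ (π ⟨$⟩ʳ_)
permutation-injective π = Injection.injective (↔⇒↣ π)

module _ {n : ℕ} (a : Fin n) where

  swapBlack : Fin (suc n) → Fin (suc n)
  swapBlack zero    = suc a
  swapBlack (suc x) = relabelBlack a x

  swapBlack-involutive : ∀ w → swapBlack (swapBlack w) ≡ w
  swapBlack-involutive zero with a ≟ a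
  ... | yes _   = refl
  ... | no  a≢a = ⊥-elim (a≢a refl)
  swapBlack-involutive (suc x) with x ≟ a
  ... | yes refl = refl
  ... | no  x≢a with x ≟ a
  ...   | yes x≡a = ⊥-elim (x≢a x≡a)
  ...   | no  _   = refl

  rerouteBlack-conjugate : ∀ (σ : Permutation′ n) w →
    rerouteBlack a (σ ⟨$⟩ʳ_) w ≡ swapBlack (lift₀ σ ⟨$⟩ʳ swapBlack w)
  rerouteBlack-conjugate σ zero    = refl
  rerouteBlack-conjugate σ (suc x) with x ≟ a
  ... | yes _ = refl
  ... | no  _ = refl

  z-rerouteBlack : ∀ (σ : Permutation′ n) → z (rerouteBlack a (σ ⟨$⟩ʳ_)) ≡ suc (z (σ ⟨$⟩ʳ_))
  z-rerouteBlack σ = trans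
    (z-conjugate (permutation-injective (lift₀ σ)) swapBlack swapBlack-involutive (rerouteBlack-conjugate σ))
    (z-lift₀ σ)

module _ {n : ℕ} (a b : Fin n) (σ : Permutation′ n) where

  private
    s : Fin n → Fin n
    s = σ ⟨$⟩ʳ_
    g : Fin (suc n) → Fin (suc n)
    g = rerouteWhite a b s

  -- Forgets a•, which sits in the cycle of b.
  dropWhite : Fin (suc n) → Fin n
  dropWhite zero    = b
  dropWhite (suc x) = x

  rerouteWhite-before-b : ∀ {x} → s x ≡ b → g (suc x) ≡ zero
  rerouteWhite-before-b {x} sx≡b with s x ≟ b
  ... | yes _    = refl
  ... | no  sx≢b = ⊥-elim (sx≢b sx≡b)

  rerouteWhite-off-b : ∀ {x} → s x ≢ b → g (suc x) ≡ suc (s x)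
  rerouteWhite-off-b {x} sx≢b with s x ≟ b
  ... | yes sx≡b = ⊥-elim (sx≢b sx≡b)
  ... | no  _    = refl

  Reach-suc-step : ∀ x → Reach g (suc x) (suc (s x))
  Reach-suc-step x with s x ≟ b
  ... | yes sx≡b = 2 , trans (cong g (rerouteWhite-before-b sx≡b)) (cong suc (sym sx≡b))
  ... | no  sx≢b = 1 , rerouteWhite-off-b sx≢b

  Reach-suc : ∀ {x y} → Reach s x y → Reach g (suc x) (suc y)
  Reach-suc = Reach-map suc Reach-suc-step

  Reach-dropWhite-step : ∀ w → Reach s (dropWhite w) (dropWhite (g w))
  Reach-dropWhite-step zero    = Reach-refl s
  Reach-dropWhite-step (suc x) with s x ≟ b
  ... | yes sx≡b = 1 , sx≡b
  ... | no  _    = Reach-step s x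

  Reach-to-suc-dropWhite : ∀ w → Reach g w (suc (dropWhite w))
  Reach-to-suc-dropWhite zero    = Reach-step g zero
  Reach-to-suc-dropWhite (suc x) = Reach-refl g

  -- a• is entered from the σ∘-predecessor of b, which b reaches since σ∘ is a permutation.
  Reach-from-suc-dropWhite : ∀ w → Reach g (suc (dropWhite w)) w
  Reach-from-suc-dropWhite (suc x) = Reach-refl g
  Reach-from-suc-dropWhite zero    =
    Reach-trans g (Reach-suc b→pred) (1 , rerouteWhite-before-b (inverseʳ σ))
    where
    b→pred : Reach s b (σ ⟨$⟩ˡ b)
    b→pred = Reach-sym s (permutation-injective σ) (1 , inverseʳ σ)

  Reach-reflect-dropWhite : ∀ {w w′} → Reach s (dropWhite w) (dropWhite w′) → Reach g w w′
  Reach-reflect-dropWhite {w} {w′} reach =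
    Reach-trans g (Reach-to-suc-dropWhite w) (Reach-trans g (Reach-suc reach) (Reach-from-suc-dropWhite w′))

  z-rerouteWhite : z g ≡ z s
  z-rerouteWhite = z-reachCorrespondence (permutation-injective σ) dropWhite
    (Reach-map dropWhite Reach-dropWhite-step) Reach-reflect-dropWhite suc (λ _ → refl)

χ-difference-ℤ : ∀ (A B M C C′ : ℤ) →
  (((A ℤ.+ B) - M) ℤ.+ C) - (((A ℤ.+ (+ 1 ℤ.+ B)) - (+ 1 ℤ.+ M)) ℤ.+ C′) ≡ C - C′
χ-difference-ℤ = solve-∀

χ-difference : ∀ {m} (f g : Fin m → Fin m) (f′ g′ : Fin (suc m) → Fin (suc m)) →
  z f′ ≡ z f → z g′ ≡ suc (z g) →
  χ f g - χ f′ g′ ≡ + z (f ∘ g) - + z (f′ ∘ g′)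
χ-difference {m} f g f′ g′ zf′≡zf zg′≡1+zg = begin
  χ f g - χ f′ g′
    ≡⟨ cong₂ (λ p q → χ f g - (((+ p ℤ.+ + q) - + suc m) ℤ.+ + z (f′ ∘ g′))) zf′≡zf zg′≡1+zg ⟩
  χ f g - (((+ z f ℤ.+ + suc (z g)) - + suc m) ℤ.+ + z (f′ ∘ g′))
    ≡⟨ cong₂ (λ p q → χ f g - (((+ z f ℤ.+ p) - q) ℤ.+ + z (f′ ∘ g′))) (pos-+ 1 (z g)) (pos-+ 1 m) ⟩
  χ f g - (((+ z f ℤ.+ (+ 1 ℤ.+ + z g)) - (+ 1 ℤ.+ + m)) ℤ.+ + z (f′ ∘ g′))
    ≡⟨ χ-difference-ℤ (+ z f) (+ z g) (+ m) (+ z (f ∘ g)) (+ z (f′ ∘ g′)) ⟩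
  + z (f ∘ g) - + z (f′ ∘ g′) ∎
  where open ≡-Reasoning

-- The identity holds for a ≡ b as well.
mainTheorem16 : (n : ℕ) (a b : Fin n) → a ≢ b →
    (σw σb : Permutation′ n) →
    χ (σw ⟨$⟩ʳ_) (σb ⟨$⟩ʳ_)
      - χ (rerouteWhite a b (σw ⟨$⟩ʳ_)) (rerouteBlack a (σb ⟨$⟩ʳ_))
    ≡ (+ z ((σw ⟨$⟩ʳ_) ∘ (σb ⟨$⟩ʳ_)))
      - (+ z (rerouteWhite a b (σw ⟨$⟩ʳ_) ∘ rerouteBlack a (σb ⟨$⟩ʳ_)))
mainTheorem16 n a b _ σw σb =
  χ-difference (σw ⟨$⟩ʳ_) (σb ⟨$⟩ʳ_) (rerouteWhite a b (σw ⟨$⟩ʳ_)) (rerouteBlack a (σb ⟨$⟩ʳ_))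
    (z-rerouteWhite a b σw) (z-rerouteBlack a σb)
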